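{- Let $L$ be a Latin square of order $n \geq 2$ and let $a\ge 0$ be an integer. The minimum size of a cover of $L$ is $n+a$ if and only if the minimum deficit of a partial transversal of $L$ is either $2a$ or $2a-1$.
   Context: A Latin square of order $n$ is an $n\times n$ array on $n$ symbols in which each symbol occurs once in each row and each column; its set of entries is $E(L)=\{(i,j,L_{ij})\}$. A line is the set of all entries in a given row, in a given column, or with a given symbol (so there are $3n$ lines). A line is represented by a set of entries if it meets that set. A cover of $L$ is a subset of $E(L)$ in which every line is represented; a $c$-cover is a cover of size $c$. A partial transversal of deficit $d$ is an $(n-d)$-subset of $E(L)$ in which every line is represented at most once. -}

module Defs where

open import Data.Nat using (ℕ; _≤_)
open import Data.Fin using (Fin)
open import Data.Product using (_×_; Σ; ∃; _,_)
open import Data.List using (List; length)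
open import Data.List.Membership.Propositional using (_∈_)
open import Data.List.Relation.Unary.Any using (Any)
open import Data.List.Relation.Unary.Unique.Propositional using (Unique)
open import Data.List.Relation.Unary.AllPairs using (AllPairs)
open import Function.Definitions using (Injective)
open import Relation.Binary.PropositionalEquality using (_≡_)
open import Relation.Nullary using (¬_)

-- A Latin square of order n on the symbol set Fin n: cell (i , j) holds
-- symbol sq i j; each symbol occurs once in each row and each column
-- (for a finite square, injectivity along rows/columns is exactly this).
record LatinSquare (n : ℕ) : Set where
  field
    sq     : Fin n → Fin n → Fin n
    rowInj : ∀ i → Injective _≡_ _≡_ (λ j → sq i j)
    colInj : ∀ j → Injective _≡_ _≡_ (λ i → sq i j)
open LatinSquare public

-- An entry (i , j , L i j) of E(L) is determined by its cell (i , j).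
Cell : ℕ → Set
Cell n = Fin n × Fin n

row : ∀ {n} → Cell n → Fin n
row (i , j) = i

col : ∀ {n} → Cell n → Fin n
col (i , j) = j

symb : ∀ {n} → LatinSquare n → Cell n → Fin n
symb L (i , j) = sq L i j

-- A set of entries is a duplicate-free list of cells; its size is its length.
-- Cover: every row, every column and every symbol line is represented.
IsCover : ∀ {n} → LatinSquare n → List (Cell n) → Set
IsCover {n} L S =
  Unique S ×
  ((r : Fin n) → Any (λ e → row e ≡ r) S) ×
  ((c : Fin n) → Any (λ e → col e ≡ c) S) ×
  ((s : Fin n) → Any (λ e → symb L e ≡ s) S)

MinCoverSize : ∀ {n} → LatinSquare n → ℕ → Set
MinCoverSize L c =
  (Σ (List (Cell _)) λ S → IsCover L S × length S ≡ c) ×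
  (∀ S → IsCover L S → c ≤ length S)

NoCommonLine : ∀ {n} → LatinSquare n → Cell n → Cell n → Set
NoCommonLine L e f = ¬ (row e ≡ row f) × ¬ (col e ≡ col f) × ¬ (symb L e ≡ symb L f)

-- Partial transversal of deficit d: a set of n - d entries (so d ≤ n) in which
-- every line is represented at most once (pairwise no common line; this also
-- makes the entries distinct).
IsPartialTransversal : ∀ {n} → LatinSquare n → ℕ → List (Cell n) → Set
IsPartialTransversal {n} L d T =
  d ≤ n × AllPairs (NoCommonLine L) T × length T Data.Nat.+ d ≡ n

MinDeficit : ∀ {n} → LatinSquare n → ℕ → Set
MinDeficit L d =
  (Σ (List (Cell _)) λ T → IsPartialTransversal L d T) ×
  (∀ d' T → IsPartialTransversal L d' T → d ≤ d')

-- Both directions follow from two constructions comparing the doubled cover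
-- size 2c with 2n + d:
--   * cover ⇒ transversal: greedily extract a partial transversal T from a
--     cover S.  Every other entry of S meets a line of T, so it represents at
--     most two further lines; all 3n lines are represented, hence
--     3n ≤ |T| + 2|S|, i.e. 2n + d ≤ 2|S| for the deficit d = n - |T|;
--   * transversal ⇒ cover: a partial transversal of deficit d misses d rows,
--     d columns and d symbols; three cells represent two (row, column,
--     symbol) triples, two cells a single one, giving a cover S with
--     2|S| ≤ 2n + d + 1.
-- The module LeastCorrespondence shows, for abstract cover and deficit
-- predicates linked by these two inequalities (deficits being decidable, so
-- that a least one exists), that least sizes correspond as in the theorem.
module Submission where

open import Defs
open import Data.Nat using (ℕ; zero; suc; _+_; _*_; _∸_; _≤_; _<_; z≤n; s≤s; _≤?_)
  renaming (_≟_ to _≟ℕ_)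
open import Data.Nat.Properties
open import Data.Nat.Tactic.RingSolver using (solve-∀)
open import Data.Fin using (Fin; fromℕ<) renaming (_≟_ to _≟ᶠ_)
open import Data.Fin.Patterns using (0F; 1F; 2F)
open import Data.Fin.Properties using () renaming (any? to anyFin?)
open import Data.Product using (Σ; _×_; _,_; proj₁; proj₂)
open import Data.Product.Properties using (≡-dec)
open import Data.Sum using (_⊎_; inj₁; inj₂)
open import Data.List
  using (List; []; _∷_; _++_; length; map; concat; allFin; filter; cartesianProduct; deduplicate)
open import Data.List.Properties using (length-++; length-map; length-tabulate; length-deduplicate)
open import Data.List.Membership.Propositional using (_∈_; find; lose)
open import Data.List.Membership.Propositional.Properties
  using (∈-∃++; ∈-++⁺ˡ; ∈-++⁺ʳ; ∈-++⁻; ∈-map⁺; ∈-map⁻; ∈-allFin; ∈-cartesianProduct⁺;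
         ∈-concat⁺′; ∈-filter⁺; ∈-filter⁻)
open import Data.List.Relation.Binary.Subset.Propositional using (_⊆_)
open import Data.List.Relation.Unary.Any using (Any; here; there; any?)
import Data.List.Relation.Unary.Any as Any
import Data.List.Relation.Unary.Any.Properties as Any
open import Data.List.Relation.Unary.All using (All)
import Data.List.Relation.Unary.All as All
open import Data.List.Relation.Unary.All.Properties using (¬Any⇒All¬)
open import Data.List.Relation.Unary.AllPairs using (AllPairs; []; _∷_; allPairs?)
import Data.List.Relation.Unary.AllPairs as AllPairs
import Data.List.Relation.Unary.AllPairs.Properties as AllPairs
open import Data.List.Relation.Unary.Unique.Propositional using (Unique)
import Data.List.Relation.Unary.Unique.Propositional.Properties as Unique
open import Data.Vec using (Vec; []; _∷_; fromList; padRight)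
open import Data.Vec.Relation.Unary.Any using () renaming (here to hereᵥ; there to thereᵥ)
open import Data.Vec.Membership.Propositional using () renaming (_∈_ to _∈ᵥ_)
open import Data.Vec.Membership.Propositional.Properties using (∈-fromList⁺)
open import Data.Empty using (⊥-elim)
open import Function.Base using (id; _∘_)
open import Function.Bundles using (_⇔_; mk⇔)
open import Function.Definitions using (Injective)
open import Relation.Binary.PropositionalEquality
open import Relation.Nullary using (¬_; Dec; yes; no)
open import Relation.Nullary.Decidable using (¬?; _×-dec_)

-- Counting in finite sets

unique-⊆-length : ∀ {A : Set} {xs ys : List A} → Unique xs → xs ⊆ ys → length xs ≤ length ys
unique-⊆-length {xs = []} _ _ = z≤n
unique-⊆-length {xs = x ∷ xs} (x∉xs ∷ unique) x∷xs⊆ys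
  with ys₁ , ys₂ , refl ← ∈-∃++ (x∷xs⊆ys (here refl)) = begin
    suc (length xs)               ≤⟨ s≤s (unique-⊆-length unique xs⊆ys₁++ys₂) ⟩
    suc (length (ys₁ ++ ys₂))     ≡⟨ cong suc (length-++ ys₁) ⟩
    suc (length ys₁ + length ys₂) ≡⟨ sym (+-suc (length ys₁) (length ys₂)) ⟩
    length ys₁ + length (x ∷ ys₂) ≡⟨ sym (length-++ ys₁) ⟩
    length (ys₁ ++ x ∷ ys₂)       ∎
  where
  open ≤-Reasoning
  -- the split point is the only occurrence of x that xs could need, and xs avoids x
  xs⊆ys₁++ys₂ : xs ⊆ ys₁ ++ ys₂
  xs⊆ys₁++ys₂ z∈xs with ∈-++⁻ ys₁ (x∷xs⊆ys (there z∈xs))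
  ... | inj₁ z∈ys₁         = ∈-++⁺ˡ z∈ys₁
  ... | inj₂ (here z≡x)    = ⊥-elim (All.lookup x∉xs z∈xs (sym z≡x))
  ... | inj₂ (there z∈ys₂) = ∈-++⁺ʳ ys₁ z∈ys₂

length-allFin : ∀ n → length (allFin n) ≡ n
length-allFin n = length-tabulate id

unique-Fin-length : ∀ {n} {xs : List (Fin n)} → Unique xs → length xs ≤ n
unique-Fin-length {n} {xs} unique =
  subst (length xs ≤_) (length-allFin n) (unique-⊆-length unique (λ {x} _ → ∈-allFin x))

-- Finite pigeonhole: an injective map Fin n → Fin n is surjective.  In a
-- Latin square it says that every symbol occurs in every row and column.
injective⇒surjective : ∀ {n} (f : Fin n → Fin n) → Injective _≡_ _≡_ f →
  ∀ s → Σ (Fin n) λ x → f x ≡ s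
injective⇒surjective {n} f f-injective s with anyFin? (λ x → f x ≟ᶠ s)
... | yes hit = hit
... | no ¬hit = ⊥-elim (1+n≰n (subst (λ k → suc k ≤ n) image-size
                          (unique-Fin-length (s∉image ∷ image-unique))))
  where
  image-size : length (map f (allFin n)) ≡ n
  image-size = trans (length-map f (allFin n)) (length-allFin n)
  image-unique : Unique (map f (allFin n))
  image-unique = Unique.map⁺ f-injective (Unique.allFin⁺ n)
  s∉image : All (λ y → ¬ s ≡ y) (map f (allFin n))
  s∉image = All.tabulate λ y∈image s≡y →
    let x , _ , y≡fx = ∈-map⁻ f y∈image in ¬hit (x , sym (trans s≡y y≡fx))

length-cartesianProduct : ∀ {A B : Set} (xs : List A) (ys : List B) →
  length (cartesianProduct xs ys) ≡ length xs * length ys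
length-cartesianProduct [] ys = refl
length-cartesianProduct (x ∷ xs) ys = begin
  length (map (x ,_) ys ++ cartesianProduct xs ys)         ≡⟨ length-++ (map (x ,_) ys) ⟩
  length (map (x ,_) ys) + length (cartesianProduct xs ys) ≡⟨ cong₂ _+_ (length-map (x ,_) ys)
                                                                       (length-cartesianProduct xs ys) ⟩
  length ys + length xs * length ys                        ∎
  where open ≡-Reasoning

drop-known : ∀ {A : Set} {x : A} {xs ys : List A} → x ∈ xs → x ∈ ys →
  Σ (List A) λ rest → suc (length rest) ≡ length xs × xs ⊆ rest ++ ys
drop-known {x = x} {ys = ys} x∈xs x∈ys with as , bs , refl ← ∈-∃++ x∈xs =
  as ++ bs , size , covered
  where
  size : suc (length (as ++ bs)) ≡ length (as ++ x ∷ bs)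
  size = begin
    suc (length (as ++ bs))     ≡⟨ cong suc (length-++ as) ⟩
    suc (length as + length bs) ≡⟨ sym (+-suc (length as) (length bs)) ⟩
    length as + length (x ∷ bs) ≡⟨ sym (length-++ as) ⟩
    length (as ++ x ∷ bs)       ∎
    where open ≡-Reasoning
  covered : as ++ x ∷ bs ⊆ (as ++ bs) ++ ys
  covered z∈ with ∈-++⁻ as z∈
  ... | inj₁ z∈as        = ∈-++⁺ˡ (∈-++⁺ˡ z∈as)
  ... | inj₂ (here refl) = ∈-++⁺ʳ (as ++ bs) x∈ys
  ... | inj₂ (there z∈bs) = ∈-++⁺ˡ (∈-++⁺ʳ as z∈bs)

∈-padRight : ∀ {A : Set} {m k} (m≤k : m ≤ k) (z : A) {xs : Vec A m} {x} →
  x ∈ᵥ xs → x ∈ᵥ padRight m≤k z xs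
∈-padRight (s≤s m≤k) z (hereᵥ refl)  = hereᵥ refl
∈-padRight (s≤s m≤k) z (thereᵥ x∈xs) = thereᵥ (∈-padRight m≤k z x∈xs)

-- Least witnesses and the abstract correspondence of minima

least-witness : ∀ {P : ℕ → Set} → (∀ k → Dec (P k)) → ∀ {m} → P m →
  Σ ℕ λ k → k ≤ m × P k × (∀ j → P j → k ≤ j)
least-witness {P} P? {m} pm = search 0 m refl (λ _ ())
  where
  -- search upwards from k, where P fails below k and k + r = m
  search : ∀ k r → k + r ≡ m → (∀ j → j < k → ¬ P j) →
    Σ ℕ λ k → k ≤ m × P k × (∀ j → P j → k ≤ j)
  search k r k+r≡m below with P? k
  ... | yes pk = k , subst (k ≤_) k+r≡m (m≤m+n k r) , pk , λ j pj → ≮⇒≥ (λ j<k → below j j<k pj)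
  search k zero    k+0≡m below | no ¬pk =
    ⊥-elim (¬pk (subst P (sym (trans (sym (+-identityʳ k)) k+0≡m)) pm))
  search k (suc r) k+r≡m below | no ¬pk =
    search (suc k) r (trans (sym (+-suc k r)) k+r≡m) below′
    where
    below′ : ∀ j → j < suc k → ¬ P j
    below′ j (s≤s j≤k) with m≤n⇒m<n∨m≡n j≤k
    ... | inj₁ j<k = below j j<k
    ... | inj₂ refl = ¬pk

halve : ∀ {x y} → 2 * x ≤ suc (2 * y) → x ≤ y
halve {x} {y} 2x≤1+2y =
  ≤-pred (*-cancelˡ-< 2 x (suc y) (subst (2 * x <_) (sym (*-suc 2 y)) (s≤s 2x≤1+2y)))

squeeze : ∀ {d m} → d ≤ m → m ≤ suc d → d ≡ m ⊎ suc d ≡ m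
squeeze d≤m m≤1+d with m≤n⇒m<n∨m≡n d≤m
... | inj₁ d<m = inj₂ (≤-antisym d<m m≤1+d)
... | inj₂ d≡m = inj₁ d≡m

unsqueeze : ∀ {d m} → d ≡ m ⊎ suc d ≡ m → d ≤ m × m ≤ suc d
unsqueeze {d} (inj₁ refl) = ≤-refl , n≤1+n d
unsqueeze {d} (inj₂ refl) = n≤1+n d , ≤-refl

LeastSize : ∀ {A : Set} → (A → Set) → (A → ℕ) → ℕ → Set
LeastSize Cov size c = (Σ _ λ x → Cov x × size x ≡ c) × (∀ x → Cov x → c ≤ size x)

LeastIndex : ∀ {B : Set} → (ℕ → B → Set) → ℕ → Set
LeastIndex Def d = Σ _ (Def d) × (∀ d′ y → Def d′ y → d ≤ d′)

-- Covers (witnesses x with Cov x, of size `size x`) and transversals of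
-- deficit d (witnesses of Def d) related by the two constructions of the
-- paper: then least cover size n + a and least deficit 2a or 2a - 1 coincide.
module LeastCorrespondence
  {A B : Set} (Cov : A → Set) (size : A → ℕ) (Def : ℕ → B → Set) (n : ℕ)
  (cover-from : ∀ {d y} → Def d y → Σ A λ x → Cov x × 2 * size x ≤ suc (2 * n + d))
  (deficit-from : ∀ {x} → Cov x → Σ ℕ λ d → Σ B (Def d) × 2 * n + d ≤ 2 * size x)
  (Def? : ∀ d → Dec (Σ B (Def d)))
  where

  private
    double : ∀ a → 2 * (n + a) ≡ 2 * n + 2 * a
    double a = *-distribˡ-+ 2 n a

  deficit-lower : ∀ {a} → LeastSize Cov size (n + a) → ∀ {d y} → Def d y → 2 * a ≤ suc d
  deficit-lower {a} (_ , least) {d} dy with x , cov , bound ← cover-from dy =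
    +-cancelˡ-≤ (2 * n) _ _ (begin
      2 * n + 2 * a   ≡⟨ sym (double a) ⟩
      2 * (n + a)     ≤⟨ *-monoʳ-≤ 2 (least x cov) ⟩
      2 * size x      ≤⟨ bound ⟩
      suc (2 * n + d) ≡⟨ sym (+-suc (2 * n) d) ⟩
      2 * n + suc d   ∎)
    where open ≤-Reasoning

  cover-lower : ∀ {a d} → LeastIndex Def d → 2 * a ≤ suc d → ∀ x → Cov x → n + a ≤ size x
  cover-lower {a} {d} (_ , least) 2a≤1+d x cov with d′ , (y , dy) , bound ← deficit-from cov =
    halve (begin
      2 * (n + a)      ≡⟨ double a ⟩
      2 * n + 2 * a    ≤⟨ +-monoʳ-≤ (2 * n) 2a≤1+d ⟩
      2 * n + suc d    ≡⟨ +-suc (2 * n) d ⟩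
      suc (2 * n + d)  ≤⟨ s≤s (+-monoʳ-≤ (2 * n) (least d′ y dy)) ⟩
      suc (2 * n + d′) ≤⟨ s≤s bound ⟩
      suc (2 * size x) ∎)
    where open ≤-Reasoning

  least-deficit : ∀ {a} → LeastSize Cov size (n + a) →
    Σ ℕ λ d → LeastIndex Def d × (d ≡ 2 * a ⊎ suc d ≡ 2 * a)
  least-deficit {a} leastCover@((x , cov , size≡) , _)
    with d₀ , t₀ , bound ← deficit-from cov
    with d , d≤d₀ , (y , dy) , least ← least-witness Def? t₀ =
    d , ((y , dy) , λ d′ y′ dy′ → least d′ (y′ , dy′)) , squeeze d≤2a (deficit-lower leastCover dy)
    where
    d≤2a : d ≤ 2 * a
    d≤2a = ≤-trans d≤d₀ (+-cancelˡ-≤ (2 * n) _ _ (begin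
      2 * n + d₀    ≤⟨ bound ⟩
      2 * size x    ≡⟨ cong (2 *_) size≡ ⟩
      2 * (n + a)   ≡⟨ double a ⟩
      2 * n + 2 * a ∎))
      where open ≤-Reasoning

  least-cover : ∀ {a d} → LeastIndex Def d → d ≡ 2 * a ⊎ suc d ≡ 2 * a →
    LeastSize Cov size (n + a)
  least-cover {a} {d} leastDef@((y , dy) , _) close with x , cov , bound ← cover-from dy =
    (x , cov , ≤-antisym (halve upper) (lower x cov)) , lower
    where
    lower : ∀ x → Cov x → n + a ≤ size x
    lower = cover-lower leastDef (proj₂ (unsqueeze close))
    upper : 2 * size x ≤ suc (2 * (n + a))
    upper = begin
      2 * size x            ≤⟨ bound ⟩
      suc (2 * n + d)       ≤⟨ s≤s (+-monoʳ-≤ (2 * n) (proj₁ (unsqueeze close))) ⟩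
      suc (2 * n + 2 * a)   ≡⟨ cong suc (sym (double a)) ⟩
      suc (2 * (n + a))     ∎
      where open ≤-Reasoning

  correspondence : ∀ a → LeastSize Cov size (n + a) ⇔
    (Σ ℕ λ d → LeastIndex Def d × (d ≡ 2 * a ⊎ suc d ≡ 2 * a))
  correspondence a = mk⇔ least-deficit (λ (d , leastDef , close) → least-cover leastDef close)

-- Lines of a Latin square and the cover ⇒ transversal construction

split-three : ∀ {t d m} → t + d ≡ m → 3 * m ≡ t + (2 * m + d)
split-three {t} {d} refl = identity t d
  where
  identity : ∀ t d → 3 * (t + d) ≡ t + (2 * (t + d) + d)
  identity = solve-∀

module Lines {n : ℕ} (L : LatinSquare n) where

  -- Line (0F , r) is row r, (1F , c) column c, (2F , s) symbol s.
  Line : Set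
  Line = Fin 3 × Fin n

  linesOf : Cell n → List Line
  linesOf e = (0F , row e) ∷ (1F , col e) ∷ (2F , symb L e) ∷ []

  allLines : List Line
  allLines = cartesianProduct (allFin 3) (allFin n)

  allLines-unique : Unique allLines
  allLines-unique = Unique.cartesianProduct⁺ (Unique.allFin⁺ 3) (Unique.allFin⁺ n)

  length-allLines : length allLines ≡ 3 * n
  length-allLines = trans (length-cartesianProduct (allFin 3) (allFin n)) (cong (3 *_) (length-allFin n))

  open import Data.List.Membership.DecPropositional (≡-dec (_≟ᶠ_ {3}) (_≟ᶠ_ {n})) using (_∈?_)

  disjoint⇒noCommonLine : ∀ {e t} → ¬ Any (_∈ linesOf t) (linesOf e) → NoCommonLine L e t
  disjoint⇒noCommonLine ¬common =
      (λ r≡ → ¬common (here (here (cong (0F ,_) r≡))))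
    , (λ c≡ → ¬common (there (here (there (here (cong (1F ,_) c≡))))))
    , (λ s≡ → ¬common (there (there (here (there (there (here (cong (2F ,_) s≡))))))))

  -- Greedy extraction of a partial transversal from a list S of entries:
  -- `lines` lists (with repetitions) every line met by S, and each entry of S
  -- outside the transversal contributes at most two of them.
  record Extraction (S : List (Cell n)) : Set where
    field
      transversal : List (Cell n)
      independent : AllPairs (NoCommonLine L) transversal
      lines       : List Line
      lines-size  : length lines ≤ length transversal + 2 * length S
      S-lines     : ∀ {e} → e ∈ S → linesOf e ⊆ lines
      T-lines     : ∀ {t} → t ∈ transversal → linesOf t ⊆ lines

  join : ∀ {e S} (E : Extraction S) → All (NoCommonLine L e) (Extraction.transversal E) →
    Extraction (e ∷ S)
  join {e} {S} E independent-e = record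
    { transversal = e ∷ transversal
    ; independent = independent-e ∷ independent
    ; lines       = linesOf e ++ lines
    ; lines-size  = ≤-trans (+-monoʳ-≤ 3 lines-size)
                            (≤-reflexive (count (length transversal) (length S)))
    ; S-lines     = λ { (here refl) → ∈-++⁺ˡ ; (there e′∈S) → ∈-++⁺ʳ (linesOf e) ∘ S-lines e′∈S }
    ; T-lines     = λ { (here refl) → ∈-++⁺ˡ ; (there t∈T) → ∈-++⁺ʳ (linesOf e) ∘ T-lines t∈T }
    }
    where
    open Extraction E
    count : ∀ t s → 3 + (t + 2 * s) ≡ suc t + 2 * suc s
    count = solve-∀

  absorb : ∀ {e S} (E : Extraction S) {ℓ} → ℓ ∈ linesOf e → ℓ ∈ Extraction.lines E →
    Extraction (e ∷ S)
  absorb {e} {S} E ℓ∈e ℓ∈lines with rest , 1+rest≡3 , e⊆ ← drop-known ℓ∈e ℓ∈lines = record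
    { transversal = transversal
    ; independent = independent
    ; lines       = rest ++ lines
    ; lines-size  = begin
        length (rest ++ lines)               ≡⟨ length-++ rest ⟩
        length rest + length lines           ≡⟨ cong (_+ length lines) (suc-injective 1+rest≡3) ⟩
        2 + length lines                     ≤⟨ +-monoʳ-≤ 2 lines-size ⟩
        2 + (length transversal + 2 * length S) ≡⟨ count (length transversal) (length S) ⟩
        length transversal + 2 * suc (length S) ∎
    ; S-lines     = λ { (here refl) → e⊆ ; (there e′∈S) → ∈-++⁺ʳ rest ∘ S-lines e′∈S }
    ; T-lines     = λ t∈T → ∈-++⁺ʳ rest ∘ T-lines t∈T
    }
    where
    open Extraction E
    open ≤-Reasoning
    count : ∀ t s → 2 + (t + 2 * s) ≡ t + 2 * suc s
    count = solve-∀

  extract : ∀ S → Extraction S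
  extract [] = record
    { transversal = [] ; independent = [] ; lines = [] ; lines-size = z≤n
    ; S-lines = λ () ; T-lines = λ () }
  extract (e ∷ S) with E ← extract S
    with any? (λ t → any? (_∈? linesOf t) (linesOf e)) (Extraction.transversal E)
  ... | yes clash with t , t∈T , common ← find clash with ℓ , ℓ∈e , ℓ∈t ← find common =
    absorb E ℓ∈e (Extraction.T-lines E t∈T ℓ∈t)
  ... | no ¬clash = join E (All.map disjoint⇒noCommonLine (¬Any⇒All¬ _ ¬clash))

  cover-lines : ∀ {S} → IsCover L S → ∀ ℓ → Σ (Cell n) λ e → e ∈ S × ℓ ∈ linesOf e
  cover-lines (_ , rows , _ , _) (0F , r) with e , e∈S , refl ← find (rows r) = e , e∈S , here refl
  cover-lines (_ , _ , cols , _) (1F , c) with e , e∈S , refl ← find (cols c) = e , e∈S , there (here refl)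
  cover-lines (_ , _ , _ , syms) (2F , s) with e , e∈S , refl ← find (syms s) =
    e , e∈S , there (there (here refl))

  transversal-from-cover : ∀ {S} → IsCover L S →
    Σ ℕ λ d → Σ (List (Cell n)) (IsPartialTransversal L d) × 2 * n + d ≤ 2 * length S
  transversal-from-cover {S} cover =
    n ∸ length transversal ,
    (transversal , m∸n≤m n (length transversal) , independent , m+[n∸m]≡n T≤n) ,
    +-cancelˡ-≤ (length transversal) _ _
      (subst (_≤ length transversal + 2 * length S)
             (split-three {length transversal} (m+[n∸m]≡n T≤n)) all-lines)
    where
    open Extraction (extract S)
    -- the rows of a partial transversal are distinct
    T≤n : length transversal ≤ n
    T≤n = subst (_≤ n) (length-map row transversal)
            (unique-Fin-length (AllPairs.map⁺ (AllPairs.map proj₁ independent)))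
    all-lines : 3 * n ≤ length transversal + 2 * length S
    all-lines = begin
      3 * n                                  ≡⟨ sym length-allLines ⟩
      length allLines                        ≤⟨ unique-⊆-length allLines-unique listed ⟩
      length lines                           ≤⟨ lines-size ⟩
      length transversal + 2 * length S      ∎
      where
      open ≤-Reasoning
      listed : allLines ⊆ lines
      listed {ℓ} _ = let e , e∈S , ℓ∈e = cover-lines cover ℓ in S-lines e∈S ℓ∈e

-- The transversal ⇒ cover construction

module _ {n : ℕ} where
  open import Data.List.Membership.DecPropositional (_≟ᶠ_ {n}) using (_∈?_; _∉?_)

  missing-values : ∀ {A : Set} (z : Fin n) (f : A → Fin n) (T : List A) {d} →
    Unique (map f T) → length T + d ≡ n →
    Σ (Vec (Fin n) d) λ v → ∀ x → x ∈ map f T ⊎ x ∈ᵥ v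
  missing-values z f T {d} unique size = padRight R≤d z (fromList R) , attained-or-missing
    where
    R : List (Fin n)
    R = filter (_∉? map f T) (allFin n)
    R≤d : length R ≤ d
    R≤d = +-cancelˡ-≤ (length T) _ _ (begin
      length T + length R          ≡⟨ +-comm (length T) (length R) ⟩
      length R + length T          ≡⟨ cong (length R +_) (sym (length-map f T)) ⟩
      length R + length (map f T)  ≡⟨ sym (length-++ R) ⟩
      length (R ++ map f T)        ≤⟨ unique-Fin-length R++fT-unique ⟩
      n                            ≡⟨ sym size ⟩
      length T + d                 ∎)
      where
      open ≤-Reasoning
      R++fT-unique : Unique (R ++ map f T)
      R++fT-unique = Unique.++⁺ (Unique.filter⁺ (_∉? map f T) (Unique.allFin⁺ n)) unique
        (λ (x∈R , x∈fT) → proj₂ (∈-filter⁻ (_∉? map f T) {xs = allFin n} x∈R) x∈fT)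
    attained-or-missing : ∀ x → x ∈ map f T ⊎ x ∈ᵥ padRight R≤d z (fromList R)
    attained-or-missing x with x ∈? map f T
    ... | yes x∈fT = inj₁ x∈fT
    ... | no  x∉fT = inj₂ (∈-padRight R≤d z (∈-fromList⁺ (∈-filter⁺ (_∉? map f T) (∈-allFin x) x∉fT)))

module Completion {n : ℕ} (L : LatinSquare n) where

  columnOf : Fin n → Fin n → Fin n
  columnOf r s = proj₁ (injective⇒surjective (sq L r) (rowInj L r) s)

  rowOf : Fin n → Fin n → Fin n
  rowOf c s = proj₁ (injective⇒surjective (λ i → sq L i c) (colInj L c) s)

  completion : ∀ {d} → Vec (Fin n) d → Vec (Fin n) d → Vec (Fin n) d → List (Cell n)
  completion [] [] [] = []
  completion (r ∷ []) (c ∷ []) (s ∷ []) = (r , columnOf r s) ∷ (r , c) ∷ []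
  completion (r₁ ∷ r₂ ∷ rs) (c₁ ∷ c₂ ∷ cs) (s₁ ∷ s₂ ∷ ss) =
    (r₁ , columnOf r₁ s₁) ∷ (rowOf c₁ s₂ , c₁) ∷ (r₂ , c₂) ∷ completion rs cs ss

  completion-size : ∀ {d} (rs cs ss : Vec (Fin n) d) → 2 * length (completion rs cs ss) ≤ suc (3 * d)
  completion-size [] [] [] = z≤n
  completion-size (r ∷ []) (c ∷ []) (s ∷ []) = ≤-refl
  completion-size {suc (suc d)} (r₁ ∷ r₂ ∷ rs) (c₁ ∷ c₂ ∷ cs) (s₁ ∷ s₂ ∷ ss) = begin
    2 * (3 + b)          ≡⟨ *-distribˡ-+ 2 3 b ⟩
    6 + 2 * b            ≤⟨ +-monoʳ-≤ 6 (completion-size rs cs ss) ⟩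
    6 + suc (3 * d)      ≡⟨ count d ⟩
    suc (3 * (2 + d))    ∎
    where
    open ≤-Reasoning
    b = length (completion rs cs ss)
    count : ∀ d → 6 + suc (3 * d) ≡ suc (3 * (2 + d))
    count = solve-∀

  completion-rows : ∀ {d} (rs cs ss : Vec (Fin n) d) {r} → r ∈ᵥ rs →
    Any (λ e → row e ≡ r) (completion rs cs ss)
  completion-rows (_ ∷ []) (_ ∷ []) (_ ∷ []) (hereᵥ refl) = here refl
  completion-rows (_ ∷ _ ∷ _) (_ ∷ _ ∷ _) (_ ∷ _ ∷ _) (hereᵥ refl) = here refl
  completion-rows (_ ∷ _ ∷ _) (_ ∷ _ ∷ _) (_ ∷ _ ∷ _) (thereᵥ (hereᵥ refl)) = there (there (here refl))
  completion-rows (_ ∷ _ ∷ rs) (_ ∷ _ ∷ cs) (_ ∷ _ ∷ ss) (thereᵥ (thereᵥ r∈rs)) =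
    there (there (there (completion-rows rs cs ss r∈rs)))

  completion-columns : ∀ {d} (rs cs ss : Vec (Fin n) d) {c} → c ∈ᵥ cs →
    Any (λ e → col e ≡ c) (completion rs cs ss)
  completion-columns (_ ∷ []) (_ ∷ []) (_ ∷ []) (hereᵥ refl) = there (here refl)
  completion-columns (_ ∷ _ ∷ _) (_ ∷ _ ∷ _) (_ ∷ _ ∷ _) (hereᵥ refl) = there (here refl)
  completion-columns (_ ∷ _ ∷ _) (_ ∷ _ ∷ _) (_ ∷ _ ∷ _) (thereᵥ (hereᵥ refl)) = there (there (here refl))
  completion-columns (_ ∷ _ ∷ rs) (_ ∷ _ ∷ cs) (_ ∷ _ ∷ ss) (thereᵥ (thereᵥ c∈cs)) =
    there (there (there (completion-columns rs cs ss c∈cs)))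

  completion-symbols : ∀ {d} (rs cs ss : Vec (Fin n) d) {s} → s ∈ᵥ ss →
    Any (λ e → symb L e ≡ s) (completion rs cs ss)
  completion-symbols (r ∷ []) (_ ∷ []) (s ∷ []) (hereᵥ refl) =
    here (proj₂ (injective⇒surjective (sq L r) (rowInj L r) s))
  completion-symbols (r₁ ∷ _ ∷ _) (_ ∷ _ ∷ _) (s₁ ∷ _ ∷ _) (hereᵥ refl) =
    here (proj₂ (injective⇒surjective (sq L r₁) (rowInj L r₁) s₁))
  completion-symbols (_ ∷ _ ∷ _) (c₁ ∷ _ ∷ _) (_ ∷ s₂ ∷ _) (thereᵥ (hereᵥ refl)) =
    there (here (proj₂ (injective⇒surjective (λ i → sq L i c₁) (colInj L c₁) s₂)))
  completion-symbols (_ ∷ _ ∷ rs) (_ ∷ _ ∷ cs) (_ ∷ _ ∷ ss) (thereᵥ (thereᵥ s∈ss)) =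
    there (there (there (completion-symbols rs cs ss s∈ss)))

  cell? : (e f : Cell n) → Dec (e ≡ f)
  cell? = ≡-dec _≟ᶠ_ _≟ᶠ_

  open import Data.List.Relation.Unary.Unique.DecPropositional.Properties cell? using (deduplicate-!)

  -- A partial transversal of deficit d extends to a cover S with 2|S| ≤ 2n + d + 1
  -- (z : Fin n only serves as padding).
  cover-from-transversal : Fin n → ∀ {d T} → IsPartialTransversal L d T →
    Σ (List (Cell n)) λ S → IsCover L S × 2 * length S ≤ suc (2 * n + d)
  cover-from-transversal z {d} {T} (_ , independent , size) =
    S , (deduplicate-! (T ++ B) , represented row missingRows (completion-rows rs cs ss)
                                , represented col missingColumns (completion-columns rs cs ss)
                                , represented (symb L) missingSymbols (completion-symbols rs cs ss)) ,
    bound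
    where
    -- the rows, columns and symbols of a partial transversal are distinct
    missingRows = missing-values z row T (AllPairs.map⁺ (AllPairs.map proj₁ independent)) size
    missingColumns = missing-values z col T (AllPairs.map⁺ (AllPairs.map (proj₁ ∘ proj₂) independent)) size
    missingSymbols = missing-values z (symb L) T (AllPairs.map⁺ (AllPairs.map (proj₂ ∘ proj₂) independent)) size
    rs = proj₁ missingRows
    cs = proj₁ missingColumns
    ss = proj₁ missingSymbols
    B : List (Cell n)
    B = completion rs cs ss
    S : List (Cell n)
    S = deduplicate cell? (T ++ B)
    represented : (f : Cell n → Fin n) (missing : Σ (Vec (Fin n) d) λ v → ∀ x → x ∈ map f T ⊎ x ∈ᵥ v) →
      (∀ {x} → x ∈ᵥ proj₁ missing → Any (λ e → f e ≡ x) B) → ∀ x → Any (λ e → f e ≡ x) S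
    represented f (v , attained-or-missing) complete x with attained-or-missing x
    ... | inj₁ x∈fT with t , t∈T , refl ← ∈-map⁻ f x∈fT =
      Any.deduplicate⁺ cell? (λ { refl fe≡x → fe≡x }) (Any.++⁺ˡ (Any.map (λ { refl → refl }) t∈T))
    ... | inj₂ x∈v = Any.deduplicate⁺ cell? (λ { refl fe≡x → fe≡x }) (Any.++⁺ʳ T (complete x∈v))
    bound : 2 * length S ≤ suc (2 * n + d)
    bound = begin
      2 * length S                  ≤⟨ *-monoʳ-≤ 2 (length-deduplicate cell? (T ++ B)) ⟩
      2 * length (T ++ B)           ≡⟨ cong (2 *_) (length-++ T) ⟩
      2 * (length T + length B)     ≡⟨ *-distribˡ-+ 2 (length T) (length B) ⟩
      2 * length T + 2 * length B   ≤⟨ +-monoʳ-≤ (2 * length T) (completion-size rs cs ss) ⟩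
      2 * length T + suc (3 * d)    ≡⟨ count (length T) d ⟩
      suc (2 * (length T + d) + d)  ≡⟨ cong (λ m → suc (2 * m + d)) size ⟩
      suc (2 * n + d)               ∎
      where
      open ≤-Reasoning
      count : ∀ t d → 2 * t + suc (3 * d) ≡ suc (2 * (t + d) + d)
      count = solve-∀

-- Decidability of the existence of a partial transversal of given deficit

listsOfLength : ∀ {A : Set} → List A → ℕ → List (List A)
listsOfLength U zero    = [] ∷ []
listsOfLength U (suc k) = concat (map (λ x → map (x ∷_) (listsOfLength U k)) U)

∈-listsOfLength : ∀ {A : Set} {U : List A} → (∀ x → x ∈ U) → ∀ xs → xs ∈ listsOfLength U (length xs)
∈-listsOfLength enum [] = here refl
∈-listsOfLength {U = U} enum (x ∷ xs) =
  ∈-concat⁺′ (∈-map⁺ (x ∷_) (∈-listsOfLength enum xs))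
             (∈-map⁺ (λ y → map (y ∷_) (listsOfLength U (length xs))) (enum x))

exists-list? : ∀ {A : Set} {P : List A → Set} (U : List A) → (∀ x → x ∈ U) →
  (∀ xs → Dec (P xs)) → ∀ k → (∀ {xs} → P xs → length xs ≡ k) → Dec (Σ (List A) P)
exists-list? {P = P} U enum P? k forced with any? P? (listsOfLength U k)
... | yes found = let xs , _ , pxs = find found in yes (xs , pxs)
... | no none = no λ (xs , pxs) →
  none (lose (subst (λ j → xs ∈ listsOfLength U j) (forced pxs) (∈-listsOfLength enum xs)) pxs)

-- Partial transversals of deficit d have n - d cells, so a finite search decides them.
transversal? : ∀ {n} (L : LatinSquare n) d → Dec (Σ (List (Cell n)) (IsPartialTransversal L d))
transversal? {n} L d = exists-list? (cartesianProduct (allFin n) (allFin n))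
  (λ (i , j) → ∈-cartesianProduct⁺ (∈-allFin i) (∈-allFin j))
  isTransversal? (n ∸ d) (λ (_ , _ , size) → trans (sym (m+n∸n≡m _ d)) (cong (_∸ d) size))
  where
  noCommonLine? : ∀ e f → Dec (NoCommonLine L e f)
  noCommonLine? e f = ¬? (row e ≟ᶠ row f) ×-dec ¬? (col e ≟ᶠ col f) ×-dec ¬? (symb L e ≟ᶠ symb L f)
  isTransversal? : ∀ T → Dec (IsPartialTransversal L d T)
  isTransversal? T = d ≤? n ×-dec allPairs? noCommonLine? T ×-dec (length T + d ≟ℕ n)

-- Theorem 2.4.  The bound 2 ≤ n provides an element of Fin n for padding.
theorem2p4 : (n : ℕ) → 2 ≤ n → (L : LatinSquare n) → (a : ℕ) →
    MinCoverSize L (n + a) ⇔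
      (Σ ℕ λ d → MinDeficit L d × (d ≡ 2 * a ⊎ suc d ≡ 2 * a))
theorem2p4 n 2≤n L a = correspondence a
  where
  open LeastCorrespondence (IsCover L) length (IsPartialTransversal L) n
    (Completion.cover-from-transversal L (fromℕ< 2≤n))
    (Lines.transversal-from-cover L)
    (transversal? L)
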